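{- Let $G$ be a graph and let $G_s$ be its spike graph. Then $b_T(G_s)=b(G)+1$.
   Context: For a finite simple graph $H$, a burning sequence is a sequence $(b_1,\dots,b_t)$ of vertices such that every vertex $v$ satisfies $d_H(v,b_i)\le t-i$ for some $i\in\{1,\dots,t\}$; $b(H)$ is the minimum length of a burning sequence. The total graph $T(G)$ has vertex set $V(G)\cup E(G)$, where two elements are adjacent iff they are adjacent vertices, edges sharing an endpoint, or a vertex and an edge incident to it; $b_T(G)=b(T(G))$. The spike graph $G_s$ of $G$ with $V(G)=\{v_1,\dots,v_n\}$ is obtained by adding new vertices $l_1,\dots,l_n$ and edges $v_il_i$ for each $i$. -}

module Defs where

open import Data.Nat using (ℕ; zero; suc; _+_; _∸_; _≤_)
open import Data.Fin using (Fin; toℕ; splitAt; _<_)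
open import Data.Fin.Properties using (_≟_)
open import Data.Bool using (Bool; true; false)
open import Data.Product using (Σ; _×_; _,_; proj₁; proj₂; ∃)
open import Data.Sum using (_⊎_; inj₁; inj₂)
open import Relation.Nullary using (¬_; yes; no)
open import Relation.Nullary.Decidable using (⌊_⌋)
open import Relation.Binary.PropositionalEquality using (_≡_; refl; sym)

data Within {V : Set} (adj : V → V → Set) : ℕ → V → V → Set where
  here : ∀ {k u} → Within adj k u u
  step : ∀ {k u w v} → adj u w → Within adj k w v → Within adj (suc k) u v

-- (b₁,…,b_t), encoded as b : Fin t → V with b_{i+1} = b i (0-indexed);
-- every vertex v has d(v, b_{i+1}) ≤ t - (i+1) for some i.
IsBurningSequence : {V : Set} (adj : V → V → Set) (t : ℕ) → (Fin t → V) → Set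
IsBurningSequence {V} adj t b =
  ∀ (v : V) → ∃ λ (i : Fin t) → Within adj (t ∸ suc (toℕ i)) v (b i)

IsBurningNumber : {V : Set} (adj : V → V → Set) → ℕ → Set
IsBurningNumber {V} adj m =
  (Σ (Fin m → V) λ b → IsBurningSequence adj m b) ×
  (∀ (t : ℕ) (b : Fin t → V) → IsBurningSequence adj t b → m ≤ t)

record SimpleGraph (n : ℕ) : Set where
  field
    adj    : Fin n → Fin n → Bool
    adj-sym : ∀ i j → adj i j ≡ adj j i
    irrefl : ∀ i → adj i i ≡ false
open SimpleGraph public

Adj : ∀ {n} → SimpleGraph n → Fin n → Fin n → Set
Adj G i j = adj G i j ≡ true

-- An (unordered) edge {i,j} is represented uniquely by i < j.
Edge : ∀ {n} → SimpleGraph n → Set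
Edge {n} G = Σ (Fin n × Fin n) λ p → (proj₁ p < proj₂ p) × Adj G (proj₁ p) (proj₂ p)

end₁ end₂ : ∀ {n} {G : SimpleGraph n} → Edge G → Fin n
end₁ ((a , _) , _) = a
end₂ ((_ , b) , _) = b

module EndsOf {n} (G : SimpleGraph n) where
  e₁ e₂ : Edge G → Fin n
  e₁ e = end₁ {G = G} e
  e₂ e = end₂ {G = G} e

TVertex : ∀ {n} → SimpleGraph n → Set
TVertex {n} G = Fin n ⊎ Edge G

Incident : ∀ {n} (G : SimpleGraph n) → Fin n → Edge G → Set
Incident G u e = u ≡ EndsOf.e₁ G e ⊎ u ≡ EndsOf.e₂ G e

TAdj : ∀ {n} (G : SimpleGraph n) → TVertex G → TVertex G → Set
TAdj G (inj₁ u) (inj₁ v) = Adj G u v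
TAdj G (inj₁ u) (inj₂ e) = Incident G u e
TAdj G (inj₂ e) (inj₁ u) = Incident G u e
TAdj G (inj₂ e) (inj₂ f) = let open EndsOf G in
  ¬ (e₁ e ≡ e₁ f × e₂ e ≡ e₂ f) ×
  (e₁ e ≡ e₁ f ⊎ e₁ e ≡ e₂ f ⊎ e₂ e ≡ e₁ f ⊎ e₂ e ≡ e₂ f)

-- Spike graph G_s on Fin (n + n): vertex v_i is the i-th element of the
-- first block (splitAt n gives inj₁ i), leaf l_i is inj₂ i.

eqb : ∀ {n} → Fin n → Fin n → Bool
eqb i j = ⌊ i ≟ j ⌋

eqb-sym : ∀ {n} (i j : Fin n) → eqb i j ≡ eqb j i
eqb-sym i j with i ≟ j | j ≟ i
... | yes _ | yes _ = refl
... | no _  | no _  = refl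
... | yes p | no q  with q (sym p)
...   | ()
eqb-sym i j | no p | yes q with p (sym q)
...   | ()

module _ {n : ℕ} (G : SimpleGraph n) where
  spAdj : Fin n ⊎ Fin n → Fin n ⊎ Fin n → Bool
  spAdj (inj₁ i) (inj₁ j) = adj G i j
  spAdj (inj₁ i) (inj₂ j) = eqb i j
  spAdj (inj₂ i) (inj₁ j) = eqb i j
  spAdj (inj₂ i) (inj₂ j) = false

  spAdj-sym : ∀ a b → spAdj a b ≡ spAdj b a
  spAdj-sym (inj₁ i) (inj₁ j) = adj-sym G i j
  spAdj-sym (inj₁ i) (inj₂ j) = eqb-sym i j
  spAdj-sym (inj₂ i) (inj₁ j) = eqb-sym i j
  spAdj-sym (inj₂ i) (inj₂ j) = refl

  spAdj-irrefl : ∀ a → spAdj a a ≡ false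
  spAdj-irrefl (inj₁ i) = irrefl G i
  spAdj-irrefl (inj₂ i) = refl

spike : ∀ {n} → SimpleGraph n → SimpleGraph (n + n)
spike {n} G = record
  { adj    = λ x y → spAdj G (splitAt n x) (splitAt n y)
  ; adj-sym = λ x y → spAdj-sym G (splitAt n x) (splitAt n y)
  ; irrefl = λ x → spAdj-irrefl G (splitAt n x)
  }

-- Send v_j and l_j to j and each edge of G_s to its ends: a walk of length k in T(G_s) then
-- projects to a walk of length at most k in G between ends. Upper bound: every element of
-- T(G_s) is within distance 1 of some v_j, and appending a source to a burning sequence raises
-- every earlier radius by one, so an optimal burning sequence of G followed by any vertex burns
-- T(G_s). Lower bound: the last source of a burning sequence of T(G_s) burns only itself, and
-- every neighbour of a leaf l_j has all its ends projecting to j, so projecting any end of each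
-- other source burns every j for which l_j is not the last source; if the last source is l_j₀,
-- the pendant edge v_j₀l_j₀ is burnt by an earlier source, one of whose ends then reaches j₀.
module Submission where

open import Defs
open import Data.Nat using (ℕ; zero; suc; _+_; _∸_; _≤_; s≤s)
open import Data.Nat.Properties using (n∸n≡0; +-∸-assoc; m≤m+n; ≤-trans)
open import Data.Fin using (Fin; _<_; toℕ; splitAt; _↑ˡ_; _↑ʳ_; inject₁; fromℕ; fromℕ<)
open import Data.Fin.Properties
  using (_≟_; splitAt-↑ˡ; splitAt-↑ʳ; splitAt⁻¹-↑ˡ; splitAt⁻¹-↑ʳ; toℕ-↑ˡ; toℕ-↑ʳ; toℕ<n;
         toℕ-inject₁; toℕ-fromℕ; ↑ʳ-injective)
open import Data.Fin.Relation.Unary.Top using (view; ‵fromℕ; ‵inj₁; view-inject₁)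
open import Data.Bool using (true)
open import Data.Bool.Properties using (T-≡)
open import Data.Product using (Σ; _×_; _,_; proj₁; proj₂; ∃)
open import Data.Sum using (_⊎_; inj₁; inj₂; reduce)
open import Data.Sum.Properties using (inj₁-injective)
open import Data.Empty using (⊥-elim)
open import Function using (_∘_; Equivalence)
open import Relation.Nullary using (¬_; Dec; yes; no)
open import Relation.Nullary.Decidable using (toWitness; fromWitness)
open import Relation.Binary.Core using (_=[_]⇒_)
open import Relation.Binary.Construct.Closure.Reflexive as Refl using (ReflClosure; [_])
open import Relation.Binary.Construct.Closure.Reflexive.Properties
  using () renaming (sym to ReflClosure-sym)
open import Relation.Binary.PropositionalEquality
  using (_≡_; _≢_; refl; sym; trans; cong; subst; subst₂)

module _ {V : Set} {_∼_ : V → V → Set} where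

  Within-suc : ∀ {k u v} → Within _∼_ k u v → Within _∼_ (suc k) u v
  Within-suc here         = here
  Within-suc (step u∼w w) = step u∼w (Within-suc w)

  Within-zero⇒≡ : ∀ {u v} → Within _∼_ 0 u v → u ≡ v
  Within-zero⇒≡ here = refl

  Within-cons : ∀ {k u w v} → ReflClosure _∼_ u w → Within _∼_ k w v → Within _∼_ (suc k) u v
  Within-cons Refl.refl w = Within-suc w
  Within-cons [ u∼w ]   w = step u∼w w

Within-map : ∀ {V W : Set} {_∼_ : V → V → Set} {_≈_ : W → W → Set} (f : V → W) →
             _∼_ =[ f ]⇒ _≈_ → ∀ {k u v} → Within _∼_ k u v → Within _≈_ k (f u) (f v)
Within-map f hom here         = here
Within-map f hom (step u∼w w) = step (hom u∼w) (Within-map f hom w)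

snoc : ∀ {A : Set} {t} → (Fin t → A) → A → Fin (suc t) → A
snoc f a i with view i
... | ‵fromℕ          = a
... | ‵inj₁ {i = j} _ = f j

snoc-inject₁ : ∀ {A : Set} {t} (f : Fin t → A) (a : A) (i : Fin t) → snoc f a (inject₁ i) ≡ f i
snoc-inject₁ f a i rewrite view-inject₁ i = refl

radius-fromℕ : ∀ t → suc t ∸ suc (toℕ (fromℕ t)) ≡ 0
radius-fromℕ t rewrite toℕ-fromℕ t = n∸n≡0 t

radius-inject₁ : ∀ {t} (i : Fin t) → suc t ∸ suc (toℕ (inject₁ i)) ≡ suc (t ∸ suc (toℕ i))
radius-inject₁ i rewrite toℕ-inject₁ i = +-∸-assoc 1 (toℕ<n i)

module _ {V : Set} {_∼_ : V → V → Set} where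

  burnt-by-last-or-earlier : ∀ {t} {b : Fin (suc t) → V} → IsBurningSequence _∼_ (suc t) b →
    ∀ v → v ≡ b (fromℕ t) ⊎ ∃ λ i → Within _∼_ (suc (t ∸ suc (toℕ i))) v (b (inject₁ i))
  burnt-by-last-or-earlier {t} {b} burn v with burn v
  ... | i , w with view i
  ... | ‵fromℕ =
    inj₁ (Within-zero⇒≡ (subst (λ r → Within _∼_ r v (b (fromℕ t))) (radius-fromℕ t) w))
  ... | ‵inj₁ {i = j} _ =
    inj₂ (j , subst (λ r → Within _∼_ r v (b (inject₁ j))) (radius-inject₁ j) w)

  snoc-isBurningSequence : ∀ {t} (f : Fin t → V) (a : V) →
    (∀ v → ∃ λ i → Within _∼_ (suc (t ∸ suc (toℕ i))) v (f i)) →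
    IsBurningSequence _∼_ (suc t) (snoc f a)
  snoc-isBurningSequence f a cover v with cover v
  ... | i , w = inject₁ i , subst₂ (λ r x → Within _∼_ r v x)
                                   (sym (radius-inject₁ i)) (sym (snoc-inject₁ f a i)) w

module TotalGraph {N : ℕ} (H : SimpleGraph N) where
  open EndsOf H

  Adj-sym : ∀ {a b} → Adj H a b → Adj H b a
  Adj-sym {a} {b} ab = trans (adj-sym H b a) ab

  Ends : TVertex H → Fin N → Set
  Ends (inj₁ u) a = a ≡ u
  Ends (inj₂ e) a = Incident H a e

  anEnd : TVertex H → Fin N
  anEnd (inj₁ u) = u
  anEnd (inj₂ e) = e₁ e

  anEnd-Ends : ∀ x → Ends x (anEnd x)
  anEnd-Ends (inj₁ u) = refl
  anEnd-Ends (inj₂ e) = inj₁ refl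

  Ends-close : ∀ x {a b} → Ends x a → Ends x b → ReflClosure (Adj H) a b
  Ends-close (inj₁ u)            refl        refl        = Refl.refl
  Ends-close (inj₂ e)            (inj₁ refl) (inj₁ refl) = Refl.refl
  Ends-close (inj₂ (_ , _ , ab)) (inj₁ refl) (inj₂ refl) = [ ab ]
  Ends-close (inj₂ (_ , _ , ab)) (inj₂ refl) (inj₁ refl) = [ Adj-sym ab ]
  Ends-close (inj₂ e)            (inj₂ refl) (inj₂ refl) = Refl.refl

  SharesEnd : Edge H → Edge H → Set
  SharesEnd e f = e₁ e ≡ e₁ f ⊎ e₁ e ≡ e₂ f ⊎ e₂ e ≡ e₁ f ⊎ e₂ e ≡ e₂ f

  SharesEnd-sym : ∀ {e f} → SharesEnd e f → SharesEnd f e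
  SharesEnd-sym (inj₁ p)               = inj₁ (sym p)
  SharesEnd-sym (inj₂ (inj₁ p))        = inj₂ (inj₂ (inj₁ (sym p)))
  SharesEnd-sym (inj₂ (inj₂ (inj₁ p))) = inj₂ (inj₁ (sym p))
  SharesEnd-sym (inj₂ (inj₂ (inj₂ p))) = inj₂ (inj₂ (inj₂ (sym p)))

  TAdj-sym : ∀ {x y} → TAdj H x y → TAdj H y x
  TAdj-sym {inj₁ u} {inj₁ v} uv = Adj-sym uv
  TAdj-sym {inj₁ u} {inj₂ e} ue = ue
  TAdj-sym {inj₂ e} {inj₁ u} ue = ue
  TAdj-sym {inj₂ e} {inj₂ f} (e≢f , ef) =
    (λ (p , q) → e≢f (sym p , sym q)) , SharesEnd-sym {e} {f} ef

  edge-neighbour-shares-end : ∀ {e y} → TAdj H (inj₂ e) y → ∃ λ c → Ends (inj₂ e) c × Ends y c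
  edge-neighbour-shares-end {e} {inj₁ u} ue                         = u , ue , refl
  edge-neighbour-shares-end {e} {inj₂ f} (_ , inj₁ p)               = e₁ e , inj₁ refl , inj₁ p
  edge-neighbour-shares-end {e} {inj₂ f} (_ , inj₂ (inj₁ p))        = e₁ e , inj₁ refl , inj₂ p
  edge-neighbour-shares-end {e} {inj₂ f} (_ , inj₂ (inj₂ (inj₁ p))) = e₂ e , inj₂ refl , inj₁ p
  edge-neighbour-shares-end {e} {inj₂ f} (_ , inj₂ (inj₂ (inj₂ p))) = e₂ e , inj₂ refl , inj₂ p

  vertex-neighbour-ends-close : ∀ {u y a} → TAdj H (inj₁ u) y → Ends y a → ReflClosure (Adj H) u a
  vertex-neighbour-ends-close {y = inj₁ v} uv refl = [ uv ]
  vertex-neighbour-ends-close {y = inj₂ e} ue a∈e  = Ends-close (inj₂ e) ue a∈e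

  TAdj⇒ends-close : ∀ {x y a} → TAdj H x y → Ends x a →
                    ∃ λ b → Ends y b × ReflClosure (Adj H) a b
  TAdj⇒ends-close {inj₁ u} {inj₁ v} uv refl = v , refl , [ uv ]
  TAdj⇒ends-close {inj₁ u} {inj₂ e} ue refl = u , ue , Refl.refl
  TAdj⇒ends-close {inj₂ e} xy a∈e with edge-neighbour-shares-end xy
  ... | c , c∈e , c∈y = c , c∈y , Ends-close (inj₂ e) a∈e c∈e

  module Projection {n : ℕ} (G : SimpleGraph n) (π : Fin N → Fin n)
                    (π-hom : ReflClosure (Adj H) =[ π ]⇒ ReflClosure (Adj G)) where

    walk⇒from-each-end : ∀ {k x y a} → Within (TAdj H) k x y → Ends x a →
                         ∃ λ b → Ends y b × Within (Adj G) k (π a) (π b)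
    walk⇒from-each-end here a∈x = _ , a∈x , here
    walk⇒from-each-end (step xw w) a∈x with TAdj⇒ends-close xw a∈x
    ... | c , c∈w , ac with walk⇒from-each-end w c∈w
    ...   | b , b∈y , cb = b , b∈y , Within-cons (π-hom ac) cb

    walk⇒to-each-end : ∀ {k x y b} → Within (TAdj H) k x y → Ends y b →
                       ∃ λ a → Ends x a × Within (Adj G) k (π a) (π b)
    walk⇒to-each-end here b∈y = _ , b∈y , here
    walk⇒to-each-end (step xw w) b∈y with walk⇒to-each-end w b∈y
    ... | c , c∈w , cb with TAdj⇒ends-close (TAdj-sym xw) c∈w
    ...   | a , a∈x , ca = a , a∈x , Within-cons (π-hom (ReflClosure-sym Adj-sym ca)) cb

eqb⇒≡ : ∀ {n} {i j : Fin n} → eqb i j ≡ true → i ≡ j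
eqb⇒≡ {i = i} {j} h = toWitness {a? = i ≟ j} (Equivalence.from T-≡ h)

eqb-refl : ∀ {n} (i : Fin n) → eqb i i ≡ true
eqb-refl i = Equivalence.to T-≡ (fromWitness {a? = i ≟ i} refl)

module Spike {n : ℕ} (G : SimpleGraph n) where
  S : SimpleGraph (n + n)
  S = spike G

  open TotalGraph S

  vtx leaf : Fin n → Fin (n + n)
  vtx j  = j ↑ˡ n
  leaf j = n ↑ʳ j

  π : Fin (n + n) → Fin n
  π = reduce ∘ splitAt n

  π-vtx : ∀ j → π (vtx j) ≡ j
  π-vtx j = cong reduce (splitAt-↑ˡ n j n)

  π-leaf : ∀ j → π (leaf j) ≡ j
  π-leaf j = cong reduce (splitAt-↑ʳ n n j)

  spAdj⇒close : ∀ p q → spAdj G p q ≡ true → ReflClosure (Adj G) (reduce p) (reduce q)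
  spAdj⇒close (inj₁ i) (inj₁ j) ij = [ ij ]
  spAdj⇒close (inj₁ i) (inj₂ j) ij rewrite eqb⇒≡ ij = Refl.refl
  spAdj⇒close (inj₂ i) (inj₁ j) ij rewrite eqb⇒≡ ij = Refl.refl

  π-hom : ReflClosure (Adj S) =[ π ]⇒ ReflClosure (Adj G)
  π-hom Refl.refl       = Refl.refl
  π-hom {a} {b} [ ab ] = spAdj⇒close (splitAt n a) (splitAt n b) ab

  open Projection G π π-hom

  vtx-hom : Adj G =[ vtx ]⇒ Adj S
  vtx-hom {a} {b} ab rewrite splitAt-↑ˡ n a n | splitAt-↑ˡ n b n = ab

  leaf-adj : ∀ {j u} → Adj S (leaf j) u → u ≡ vtx j
  leaf-adj {j} {u} lu = sym (splitAt⁻¹-↑ˡ (only-vtx (splitAt n u) lu′))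
    where
    lu′ : spAdj G (inj₂ j) (splitAt n u) ≡ true
    lu′ = subst (λ p → spAdj G p (splitAt n u) ≡ true) (splitAt-↑ʳ n n j) lu
    only-vtx : ∀ q → spAdj G (inj₂ j) q ≡ true → q ≡ inj₁ j
    only-vtx (inj₁ k) jk = cong inj₁ (sym (eqb⇒≡ jk))

  leaf-close⇒π : ∀ {j a} → ReflClosure (Adj S) (leaf j) a → π a ≡ j
  leaf-close⇒π {j} Refl.refl = π-leaf j
  leaf-close⇒π {j} [ la ] rewrite leaf-adj la = π-vtx j

  pendant : Fin n → Edge S
  pendant j = (vtx j , leaf j) , vtx<leaf , vtx-leaf
    where
    vtx<leaf : vtx j < leaf j
    vtx<leaf rewrite toℕ-↑ˡ j n | toℕ-↑ʳ n j = ≤-trans (toℕ<n j) (m≤m+n n (toℕ j))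
    vtx-leaf : Adj S (vtx j) (leaf j)
    vtx-leaf rewrite splitAt-↑ˡ n j n | splitAt-↑ʳ n n j = eqb-refl j

  pendant-ends⇒π : ∀ {j a} → Ends (inj₂ (pendant j)) a → π a ≡ j
  pendant-ends⇒π {j} (inj₁ refl) = π-vtx j
  pendant-ends⇒π {j} (inj₂ refl) = π-leaf j

  near-vtx : ∀ x → ∃ λ a → ReflClosure (TAdj S) x (inj₁ (vtx a))
  near-vtx (inj₁ u) with splitAt n u in eq
  ... | inj₁ a rewrite sym (splitAt⁻¹-↑ˡ eq) = a , Refl.refl
  ... | inj₂ a rewrite sym (splitAt⁻¹-↑ʳ eq) = a , [ lv ]
    where
    lv : Adj S (leaf a) (vtx a)
    lv rewrite splitAt-↑ʳ n n a | splitAt-↑ˡ n a n = eqb-refl a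
  near-vtx (inj₂ e@((p , q) , _ , pq)) = near-end (splitAt n p) refl
    where
    near-end : ∀ s → splitAt n p ≡ s → ∃ λ a → ReflClosure (TAdj S) (inj₂ e) (inj₁ (vtx a))
    near-end (inj₁ a) eq = a , [ inj₁ (splitAt⁻¹-↑ˡ eq) ]
    near-end (inj₂ a) eq =
      a , [ inj₂ (sym (leaf-adj (subst (λ l → Adj S l q) (sym (splitAt⁻¹-↑ʳ eq)) pq))) ]

  leaf-walk : ∀ {r j y b} → Within (TAdj S) (suc r) (inj₁ (leaf j)) y → Ends y b →
              Within (Adj G) r j (π b)
  leaf-walk {j = j} here refl = subst (λ i → Within (Adj G) _ i (π (leaf j))) (π-leaf j) here
  leaf-walk (step lw w) b∈y with walk⇒to-each-end w b∈y
  ... | a , a∈w , ab =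
    subst (λ i → Within (Adj G) _ i _) (leaf-close⇒π (vertex-neighbour-ends-close lw a∈w)) ab

  pendant-walk : ∀ {r j y} → Within (TAdj S) (suc r) (inj₂ (pendant j)) y →
                 ∃ λ b → Ends y b × Within (Adj G) r j (π b)
  pendant-walk {j = j} here =
    vtx j , inj₁ refl , subst (λ i → Within (Adj G) _ j i) (sym (π-vtx j)) here
  pendant-walk (step ew w) with edge-neighbour-shares-end ew
  ... | c , c∈e , c∈w with walk⇒from-each-end w c∈w
  ...   | b , b∈y , cb = b , b∈y , subst (λ i → Within (Adj G) _ i _) (pendant-ends⇒π c∈e) cb

  is-leaf? : (x : TVertex S) → Dec (∃ λ j → x ≡ inj₁ (leaf j))
  is-leaf? (inj₂ e) = no λ ()
  is-leaf? (inj₁ u) with splitAt n u in eq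
  ... | inj₂ j = yes (j , cong inj₁ (sym (splitAt⁻¹-↑ʳ eq)))
  ... | inj₁ a = no λ { (j , refl) → vertex≢leaf (trans (sym eq) (splitAt-↑ʳ n n j)) }
    where
    vertex≢leaf : ∀ {j} → inj₁ a ≢ inj₂ j
    vertex≢leaf ()

  lift-burning : ∀ {m} (B : Fin m → Fin n) (z : Fin n) → IsBurningSequence (Adj G) m B →
                  IsBurningSequence (TAdj S) (suc m) (snoc (inj₁ ∘ vtx ∘ B) (inj₁ (vtx z)))
  lift-burning {m} B z burn = snoc-isBurningSequence _ _ cover
    where
    cover : ∀ x → ∃ λ i → Within (TAdj S) (suc (m ∸ suc (toℕ i))) x (inj₁ (vtx (B i)))
    cover x with near-vtx x
    ... | a , x≈a with burn a
    ...   | i , w = i , Within-cons x≈a (Within-map (inj₁ ∘ vtx) vtx-hom w)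

  module Lower {t : ℕ} {b : Fin (suc t) → TVertex S}
               (burn : IsBurningSequence (TAdj S) (suc t) b) where

    EndChoice : Set
    EndChoice = (i : Fin t) → ∃ (Ends (b (inject₁ i)))

    centres : EndChoice → Fin t → Fin n
    centres ch = π ∘ proj₁ ∘ ch

    Covered : EndChoice → Fin n → Set
    Covered ch j = ∃ λ i → Within (Adj G) (t ∸ suc (toℕ i)) j (centres ch i)

    covered-unless-last : ∀ ch j → (b (fromℕ t) ≡ inj₁ (leaf j) → Covered ch j) → Covered ch j
    covered-unless-last ch j last with burnt-by-last-or-earlier burn (inj₁ (leaf j))
    ... | inj₁ leaf≡last = last (sym leaf≡last)
    ... | inj₂ (i , w)   = i , leaf-walk w (proj₂ (ch i))

    burning-from : (ch : EndChoice) → (∀ j → b (fromℕ t) ≡ inj₁ (leaf j) → Covered ch j) →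
                   Σ (Fin t → Fin n) (IsBurningSequence (Adj G) t)
    burning-from ch last = centres ch , λ j → covered-unless-last ch j (last j)

    edge≢vertex : ∀ {e u} → _≢_ {A = TVertex S} (inj₂ e) (inj₁ u)
    edge≢vertex ()

    anyEnds : EndChoice
    anyEnds i = anEnd (b (inject₁ i)) , anEnd-Ends (b (inject₁ i))

    project-burning : Σ (Fin t → Fin n) (IsBurningSequence (Adj G) t)
    project-burning with is-leaf? (b (fromℕ t))
    ... | no last≢leaf = burning-from anyEnds λ j last≡leaf → ⊥-elim (last≢leaf (j , last≡leaf))
    ... | yes (j₀ , last≡leaf₀) with burnt-by-last-or-earlier burn (inj₂ (pendant j₀))
    ...   | inj₁ pendant≡last = ⊥-elim (edge≢vertex (trans pendant≡last last≡leaf₀))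
    ...   | inj₂ (i₀ , w) with pendant-walk w
    ...     | s , s∈ , j₀s = burning-from ch λ j last≡leaf →
                i₀ , subst₂ (λ k c → Within (Adj G) _ k c) (same-leaf last≡leaf) (sym chosen) j₀s
      where
      ch : EndChoice
      ch i with i ≟ i₀
      ... | yes refl = s , s∈
      ... | no _     = anyEnds i
      chosen : centres ch i₀ ≡ π s
      chosen with i₀ ≟ i₀
      ... | yes refl = refl
      ... | no i₀≢i₀ = ⊥-elim (i₀≢i₀ refl)
      same-leaf : ∀ {j} → b (fromℕ t) ≡ inj₁ (leaf j) → j₀ ≡ j
      same-leaf last≡leaf =
        ↑ʳ-injective n j₀ _ (inj₁-injective (trans (sym last≡leaf₀) last≡leaf))

  no-empty-burning : Fin n → ∀ {b} → ¬ IsBurningSequence (TAdj S) 0 b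
  no-empty-burning z burn with burn (inj₁ (vtx z))
  ... | () , _

lemma7 : ∀ {n : ℕ} (G : SimpleGraph n) → 1 ≤ n → (m : ℕ) →
         IsBurningNumber (Adj G) m →
         IsBurningNumber (TAdj (spike G)) (suc m)
lemma7 G 1≤n m ((B , burnG) , minimal) = (_ , lift-burning B z burnG) , minimal′
  where
  open Spike G
  z : Fin _
  z = fromℕ< 1≤n
  minimal′ : ∀ t b → IsBurningSequence (TAdj S) t b → suc m ≤ t
  minimal′ zero    b burn = ⊥-elim (no-empty-burning z burn)
  minimal′ (suc t) b burn = s≤s (minimal t _ (proj₂ (Lower.project-burning burn)))
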